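{- Let $P_n$ be the path graph on $n$ vertices and $k$ a positive integer. Then $$\lambda_v^k(P_n)=\begin{cases}0 & \text{if } k>1,\\ \lfloor n/3\rfloor & \text{if } k=1.\end{cases}$$
   Context: Let $\lambda(G)$ denote the chromatic index of a simple graph $G$. For a positive integer $k$ and a graph $G=(V,E)$, a set $V'\subseteq V$ is a $k$-chromatic index vertex removal set if $\lambda(G-V')\le k$, where $G-V'$ is obtained by deleting the vertices of $V'$ and their incident edges. The parameter $\lambda_v^k(G)$ is the minimum of $|V'|$ over all $k$-chromatic index vertex removal sets $V'$. -}

module Defs where

open import Data.Nat using (ℕ; zero; suc; _≤_)
open import Data.Fin using (Fin; toℕ)
open import Data.Fin.Subset using (Subset; _∈_; _∉_; ∣_∣)
open import Data.Product using (Σ; ∃; _×_; _,_; proj₁)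
open import Data.Sum using (_⊎_)
open import Data.Empty using (⊥)
open import Relation.Nullary using (¬_)
open import Relation.Binary.PropositionalEquality using (_≡_; _≢_)

record Graph (V : Set) : Set₁ where
  field
    Adj     : V → V → Set
    sym     : ∀ {u v} → Adj u v → Adj v u
    irrefl  : ∀ {v} → ¬ Adj v v
open Graph public

Path : (n : ℕ) → Graph (Fin n)
Adj    (Path n) i j = (toℕ j ≡ suc (toℕ i)) ⊎ (toℕ i ≡ suc (toℕ j))
sym    (Path n) (Data.Sum.inj₁ e) = Data.Sum.inj₂ e
sym    (Path n) (Data.Sum.inj₂ e) = Data.Sum.inj₁ e
irrefl (Path n) (Data.Sum.inj₁ e) = n≢sn e
  where
  n≢sn : ∀ {m} → m ≡ suc m → ⊥
  n≢sn ()
irrefl (Path n) (Data.Sum.inj₂ e) = n≢sn e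
  where
  n≢sn : ∀ {m} → m ≡ suc m → ⊥
  n≢sn ()

_─_ : ∀ {n} → Graph (Fin n) → (V' : Subset n) → Graph (Σ (Fin n) (λ v → v ∉ V'))
_─_ {n} G V' = record
  { Adj    = λ u v → Adj G (proj₁ u) (proj₁ v)
  ; sym    = sym G
  ; irrefl = irrefl G
  }

record ProperEdgeColouring {V : Set} (G : Graph V) (k : ℕ) : Set where
  field
    colour    : V → V → Fin k
    symmetric : ∀ {u v} → Adj G u v → colour u v ≡ colour v u
    proper    : ∀ {u v w} → Adj G u v → Adj G u w → v ≢ w → colour u v ≢ colour u w

IsChromaticIndex : {V : Set} → Graph V → ℕ → Set
IsChromaticIndex G χ = ProperEdgeColouring G χ × (∀ m → ProperEdgeColouring G m → χ ≤ m)

ChromaticIndexAtMost : {V : Set} → Graph V → ℕ → Set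
ChromaticIndexAtMost G k = ∃ λ χ → IsChromaticIndex G χ × χ ≤ k

IsRemovalSet : ∀ {n} → Graph (Fin n) → ℕ → Subset n → Set
IsRemovalSet G k V' = ChromaticIndexAtMost (G ─ V') k

IsLambdaV : ∀ {n} → Graph (Fin n) → ℕ → ℕ → Set
IsLambdaV {n} G k m =
  (∃ λ (V' : Subset n) → IsRemovalSet G k V' × ∣ V' ∣ ≡ m)
  × (∀ (V' : Subset n) → IsRemovalSet G k V' → m ≤ ∣ V' ∣)

-- A path with some vertices deleted is a disjoint union of paths, so it is
-- 1-edge-colourable exactly when no three consecutive vertices survive, and
-- always 2-edge-colourable (colour the edge {i, i+1} by the parity of i).
-- Hence for k ≥ 2 nothing has to be removed, while for k = 1 the removal set
-- must meet each of the ⌊n/3⌋ disjoint blocks {3t, 3t+1, 3t+2}, and taking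
-- every third vertex attains this.
module Submission where

open import Defs
open import Data.Nat using (ℕ; _≤_; _<_; _/_)
open import Data.Product using (_×_)
open import Relation.Binary.PropositionalEquality using (_≡_)

open import Data.Bool using (T; _∨_)
open import Data.Empty using (⊥; ⊥-elim)
open import Data.Fin using (Fin; zero; suc; toℕ)
open import Data.Fin.Properties using (toℕ-injective; toℕ<n; any?)
open import Data.Fin.Subset using (Subset; _∉_; ∣_∣; inside; outside)
  renaming (⊥ to ∅)
open import Data.Fin.Subset.Properties using (_∈?_; ∉⊥; ∣⊥∣≡0; ∣p∣≤∣x∷p∣)
open import Data.Nat.Base using (zero; suc; _+_; z≤n; s≤s; _⊓_)
open import Data.Nat.DivMod using (m/n≡1+[m∸n]/n)
open import Data.Nat.Properties
  using (suc-injective; n≤1+n; <⇒≤; ≤-refl; ≤-trans; ≤-reflexive; ≤⇒≯; <-irrefl; <-trans;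
         m≤n⇒m⊓n≡m; m≥n⇒m⊓n≡n; ⊓-comm; module ≤-Reasoning)
open import Data.Product using (_,_; proj₁)
open import Data.Sum using (_⊎_; inj₁; inj₂)
open import Data.Unit using (⊤; tt)
open import Data.Vec using ([]; _∷_)
open import Data.Vec.Base using (here; there)
open import Relation.Nullary using (¬_; ¬?; Dec; yes; no)
open import Relation.Binary.PropositionalEquality as ≡ using (_≢_; refl; trans; cong; subst; ≢-sym)

private
  variable
    V : Set
    n m k : ℕ

MaxDegree≤1 : Graph V → Set
MaxDegree≤1 G = ∀ u v w → Adj G u v → Adj G u w → v ≢ w → ⊥

distinct⇒2≤ : {a b : Fin m} → a ≢ b → 2 ≤ m
distinct⇒2≤ {suc (suc _)} _ = s≤s (s≤s z≤n)
distinct⇒2≤ {suc zero} {zero} {zero} a≢b = ⊥-elim (a≢b refl)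

-- The colour function is total on pairs of vertices, not only on edges, so a
-- single vertex already forces at least one colour.
1≤colours : {G : Graph V} → V → ProperEdgeColouring G m → 1 ≤ m
1≤colours v c = ≤-trans (s≤s z≤n) (toℕ<n (ProperEdgeColouring.colour c v v))

2≤colours : {G : Graph V} {u v w : V} →
  Adj G u v → Adj G u w → v ≢ w → ProperEdgeColouring G m → 2 ≤ m
2≤colours uv uw v≢w c = distinct⇒2≤ (ProperEdgeColouring.proper c uv uw v≢w)

constantColouring : {G : Graph V} → MaxDegree≤1 G → ProperEdgeColouring G 1
constantColouring deg = record
  { colour    = λ _ _ → zero
  ; symmetric = λ _ → refl
  ; proper    = λ {u} {v} {w} uv uw v≢w _ → deg u v w uv uw v≢w
  }

isChromaticIndex-empty : {G : Graph V} → ¬ V → IsChromaticIndex G 0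
isChromaticIndex-empty {G = G} ¬v = colouring , λ _ _ → z≤n
  where
  colouring : ProperEdgeColouring G 0
  colouring = record
    { colour    = λ u _ → ⊥-elim (¬v u)
    ; symmetric = λ {u} _ → ⊥-elim (¬v u)
    ; proper    = λ {u} _ _ _ _ → ¬v u
    }

chromaticIndexAtMost-mono : {G : Graph V} → m ≤ k → ChromaticIndexAtMost G m → ChromaticIndexAtMost G k
chromaticIndexAtMost-mono m≤k (χ , isχ , χ≤m) = χ , isχ , ≤-trans χ≤m m≤k

maxDegree≤1⇒chromaticIndexAtMost-1 : {G : Graph V} → Dec V → MaxDegree≤1 G → ChromaticIndexAtMost G 1
maxDegree≤1⇒chromaticIndexAtMost-1 (yes v) deg = 1 , (constantColouring deg , λ _ → 1≤colours v) , ≤-refl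
maxDegree≤1⇒chromaticIndexAtMost-1 (no ¬v) _   = 0 , isChromaticIndex-empty ¬v , z≤n

chromaticIndexAtMost-1⇒maxDegree≤1 : {G : Graph V} → ChromaticIndexAtMost G 1 → MaxDegree≤1 G
chromaticIndexAtMost-1⇒maxDegree≤1 (_ , (c , _) , χ≤1) _ _ _ uv uw v≢w = ≤⇒≯ χ≤1 (2≤colours uv uw v≢w c)

-- Proofs of v ∉ V' are irrelevant (⊥ is), so vertices of G ─ V' are equal
-- as soon as the underlying vertices of G are.
restrictColouring : {G : Graph (Fin n)} {V' : Subset n} →
  ProperEdgeColouring G k → ProperEdgeColouring (G ─ V') k
restrictColouring c = record
  { colour    = λ u v → colour (proj₁ u) (proj₁ v)
  ; symmetric = symmetric
  ; proper    = λ uv uw v≢w → proper uv uw (λ { refl → v≢w refl })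
  }
  where open ProperEdgeColouring c

Consecutive : Fin n → Fin n → Fin n → Set
Consecutive i j l = toℕ j ≡ suc (toℕ i) × toℕ l ≡ suc (toℕ j)

path-neighbours : {i j l : Fin n} → Adj (Path n) i j → Adj (Path n) i l → j ≢ l →
  Consecutive l i j ⊎ Consecutive j i l
path-neighbours (inj₁ j≡1+i) (inj₁ l≡1+i) j≢l = ⊥-elim (j≢l (toℕ-injective (trans j≡1+i (≡.sym l≡1+i))))
path-neighbours (inj₁ j≡1+i) (inj₂ i≡1+l) _   = inj₁ (i≡1+l , j≡1+i)
path-neighbours (inj₂ i≡1+j) (inj₁ l≡1+i) _   = inj₂ (i≡1+j , l≡1+i)
path-neighbours (inj₂ i≡1+j) (inj₂ i≡1+l) j≢l = ⊥-elim (j≢l (toℕ-injective (suc-injective (trans (≡.sym i≡1+j) i≡1+l))))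

parity : ℕ → Fin 2
parity zero          = zero
parity (suc zero)    = suc zero
parity (suc (suc n)) = parity n

parity-suc : ∀ n → parity (suc n) ≢ parity n
parity-suc zero          ()
parity-suc (suc zero)    ()
parity-suc (suc (suc n)) = parity-suc n

pathEdgeColour : Fin n → Fin n → Fin 2
pathEdgeColour u v = parity (toℕ u ⊓ toℕ v)

consecutive⇒edgeColours-differ : {a b c : Fin n} → Consecutive a b c →
  pathEdgeColour b a ≢ pathEdgeColour b c
consecutive⇒edgeColours-differ {a = a} {b} {c} (b≡1+a , c≡1+b) same = parity-suc (toℕ a) (begin
  parity (suc (toℕ a))  ≡⟨ cong parity b≡1+a ⟨
  parity (toℕ b)        ≡⟨ cong parity b⊓c≡b ⟨
  pathEdgeColour b c    ≡⟨ same ⟨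
  pathEdgeColour b a    ≡⟨ cong parity b⊓a≡a ⟩
  parity (toℕ a)        ∎)
  where
  open ≡.≡-Reasoning
  b⊓a≡a : toℕ b ⊓ toℕ a ≡ toℕ a
  b⊓a≡a = m≥n⇒m⊓n≡n (subst (toℕ a ≤_) (≡.sym b≡1+a) (n≤1+n _))
  b⊓c≡b : toℕ b ⊓ toℕ c ≡ toℕ b
  b⊓c≡b = m≤n⇒m⊓n≡m (subst (toℕ b ≤_) (≡.sym c≡1+b) (n≤1+n _))

pathColouring₂ : ProperEdgeColouring (Path n) 2
pathColouring₂ = record
  { colour    = pathEdgeColour
  ; symmetric = λ {u} {v} _ → cong parity (⊓-comm (toℕ u) (toℕ v))
  ; proper    = λ uv uw v≢w → neighbourColoursDiffer (path-neighbours uv uw v≢w)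
  }
  where
  neighbourColoursDiffer : {u v w : Fin _} → Consecutive w u v ⊎ Consecutive v u w → pathEdgeColour u v ≢ pathEdgeColour u w
  neighbourColoursDiffer (inj₁ wuv) = ≢-sym (consecutive⇒edgeColours-differ wuv)
  neighbourColoursDiffer (inj₂ vuw) = consecutive⇒edgeColours-differ vuw

consecutive-ends-distinct : {i j l : Fin n} → Consecutive i j l → i ≢ l
consecutive-ends-distinct (j≡1+i , l≡1+j) i≡l =
  <-irrefl (cong toℕ i≡l) (<-trans (≤-reflexive (≡.sym j≡1+i)) (≤-reflexive (≡.sym l≡1+j)))

HitsConsecutiveTriples : Subset n → Set
HitsConsecutiveTriples V' = ∀ {i j l} → Consecutive i j l → i ∉ V' → j ∉ V' → l ∉ V' → ⊥

hitsConsecutiveTriples⇒maxDegree≤1 : (V' : Subset n) →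
  HitsConsecutiveTriples V' → MaxDegree≤1 (Path n ─ V')
hitsConsecutiveTriples⇒maxDegree≤1 _ hits (u , u∉) (v , v∉) (w , w∉) uv uw v≢w
  with path-neighbours uv uw (λ { refl → v≢w refl })
... | inj₁ wuv = hits wuv w∉ u∉ v∉
... | inj₂ vuw = hits vuw v∉ u∉ w∉

maxDegree≤1⇒hitsConsecutiveTriples : (V' : Subset n) →
  MaxDegree≤1 (Path n ─ V') → HitsConsecutiveTriples V'
maxDegree≤1⇒hitsConsecutiveTriples _ deg ijl@(j≡1+i , l≡1+j) i∉ j∉ l∉ =
  deg (_ , j∉) (_ , i∉) (_ , l∉) (inj₂ j≡1+i) (inj₁ l≡1+j)
    (λ i≡l → consecutive-ends-distinct ijl (cong proj₁ i≡l))

-- The same condition read off the characteristic vector, window by window;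
-- this is the form that supports induction on n.
HitsWindows : Subset n → Set
HitsWindows (x ∷ y ∷ z ∷ r) = T (x ∨ y ∨ z) × HitsWindows (y ∷ z ∷ r)
HitsWindows _               = ⊤

hitsWindows-tail : ∀ x (p : Subset n) → HitsWindows (x ∷ p) → HitsWindows p
hitsWindows-tail _ []          _       = tt
hitsWindows-tail _ (_ ∷ [])    _       = tt
hitsWindows-tail _ (_ ∷ _ ∷ _) (_ , h) = h

hitWindow⇒hitsFirstTriple : ∀ x y z (r : Subset n) → T (x ∨ y ∨ z) →
  zero ∉ x ∷ y ∷ z ∷ r → suc zero ∉ x ∷ y ∷ z ∷ r → suc (suc zero) ∉ x ∷ y ∷ z ∷ r → ⊥
hitWindow⇒hitsFirstTriple outside outside outside _ ()
hitWindow⇒hitsFirstTriple inside  _       _       _ _ 0∉ _  _  = 0∉ here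
hitWindow⇒hitsFirstTriple outside inside  _       _ _ _  1∉ _  = 1∉ (there here)
hitWindow⇒hitsFirstTriple outside outside inside  _ _ _  _  2∉ = 2∉ (there (there here))

hitsWindows⇒hitsConsecutiveTriples : (p : Subset n) → HitsWindows p → HitsConsecutiveTriples p
hitsWindows⇒hitsConsecutiveTriples (x ∷ y ∷ z ∷ r) (hit , _) {zero} {suc zero} {suc (suc zero)} _ =
  hitWindow⇒hitsFirstTriple x y z r hit
hitsWindows⇒hitsConsecutiveTriples (x ∷ p) h {suc _} {suc _} {suc _} (j≡1+i , l≡1+j) i∉ j∉ l∉ =
  hitsWindows⇒hitsConsecutiveTriples p (hitsWindows-tail x p h) (suc-injective j≡1+i , suc-injective l≡1+j)
    (λ i∈ → i∉ (there i∈)) (λ j∈ → j∉ (there j∈)) (λ l∈ → l∉ (there l∈))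
hitsWindows⇒hitsConsecutiveTriples _ _ {zero}  {zero}                       (() , _)
hitsWindows⇒hitsConsecutiveTriples _ _ {zero}  {suc (suc _)}                (() , _)
hitsWindows⇒hitsConsecutiveTriples _ _ {zero}  {suc zero} {zero}            (_ , ())
hitsWindows⇒hitsConsecutiveTriples _ _ {zero}  {suc zero} {suc zero}        (_ , ())
hitsWindows⇒hitsConsecutiveTriples _ _ {zero}  {suc zero} {suc (suc (suc _))} (_ , ())
hitsWindows⇒hitsConsecutiveTriples _ _ {suc _} {zero}                       (() , _)
hitsWindows⇒hitsConsecutiveTriples _ _ {suc _} {suc _}    {zero}            (_ , ())

hitsConsecutiveTriples-tail : ∀ x (p : Subset n) → HitsConsecutiveTriples (x ∷ p) → HitsConsecutiveTriples p
hitsConsecutiveTriples-tail _ _ hits (j≡1+i , l≡1+j) i∉ j∉ l∉ =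
  hits (cong suc j≡1+i , cong suc l≡1+j)
    (λ { (there i∈) → i∉ i∈ }) (λ { (there j∈) → j∉ j∈ }) (λ { (there l∈) → l∉ l∈ })

hitsConsecutiveTriples⇒hitsWindows : (p : Subset n) → HitsConsecutiveTriples p → HitsWindows p
hitsConsecutiveTriples⇒hitsWindows []          _ = tt
hitsConsecutiveTriples⇒hitsWindows (_ ∷ [])    _ = tt
hitsConsecutiveTriples⇒hitsWindows (_ ∷ _ ∷ []) _ = tt
hitsConsecutiveTriples⇒hitsWindows (x ∷ y ∷ z ∷ r) hits =
  firstWindow x y z hits ,
  hitsConsecutiveTriples⇒hitsWindows (y ∷ z ∷ r) (hitsConsecutiveTriples-tail x (y ∷ z ∷ r) hits)
  where
  firstWindow : ∀ x y z → HitsConsecutiveTriples (x ∷ y ∷ z ∷ r) → T (x ∨ y ∨ z)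
  firstWindow inside  _       _       _    = tt
  firstWindow outside inside  _       _    = tt
  firstWindow outside outside inside  _    = tt
  firstWindow outside outside outside hits =
    hits {zero} {suc zero} {suc (suc zero)} (refl , refl)
      (λ ()) (λ { (there ()) }) (λ { (there (there ())) })

[3+n]/3≡1+n/3 : ∀ n → (3 + n) / 3 ≡ suc (n / 3)
[3+n]/3≡1+n/3 n = m/n≡1+[m∸n]/n {3 + n} (s≤s (s≤s (s≤s z≤n)))

hitWindow-count : ∀ x y z (r : Subset n) → T (x ∨ y ∨ z) → suc ∣ r ∣ ≤ ∣ x ∷ y ∷ z ∷ r ∣
hitWindow-count inside  y       z      r _ = s≤s (≤-trans (∣p∣≤∣x∷p∣ z r) (∣p∣≤∣x∷p∣ y (z ∷ r)))
hitWindow-count outside inside  z      r _ = s≤s (∣p∣≤∣x∷p∣ z r)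
hitWindow-count outside outside inside r _ = ≤-refl

hitsWindows⇒n/3≤∣p∣ : (p : Subset n) → HitsWindows p → n / 3 ≤ ∣ p ∣
hitsWindows⇒n/3≤∣p∣ []           _ = z≤n
hitsWindows⇒n/3≤∣p∣ (_ ∷ [])     _ = z≤n
hitsWindows⇒n/3≤∣p∣ (_ ∷ _ ∷ []) _ = z≤n
hitsWindows⇒n/3≤∣p∣ {suc (suc (suc n))} (x ∷ y ∷ z ∷ r) (hit , h) = begin
  (3 + n) / 3          ≡⟨ [3+n]/3≡1+n/3 n ⟩
  suc (n / 3)          ≤⟨ s≤s (hitsWindows⇒n/3≤∣p∣ r (hitsWindows-tail z r (hitsWindows-tail y (z ∷ r) h))) ⟩
  suc ∣ r ∣            ≤⟨ hitWindow-count x y z r hit ⟩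
  ∣ x ∷ y ∷ z ∷ r ∣    ∎
  where open ≤-Reasoning

every3rd : ∀ n → Subset n
every3rd (suc (suc (suc n))) = outside ∷ outside ∷ inside ∷ every3rd n
every3rd _                   = ∅

∣every3rd∣≡n/3 : ∀ n → ∣ every3rd n ∣ ≡ n / 3
∣every3rd∣≡n/3 (suc (suc (suc n))) = trans (cong suc (∣every3rd∣≡n/3 n)) (≡.sym ([3+n]/3≡1+n/3 n))
∣every3rd∣≡n/3 0                   = refl
∣every3rd∣≡n/3 1                   = refl
∣every3rd∣≡n/3 2                   = refl

hitsWindows-every3rd : ∀ n → HitsWindows (every3rd n)
hitsWindows-every3rd (suc (suc (suc n))) = tt , afterOutside (every3rd n) (hitsWindows-every3rd n)
  where
  afterInside : (q : Subset n) → HitsWindows q → HitsWindows (inside ∷ q)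
  afterInside []          _ = tt
  afterInside (_ ∷ [])    _ = tt
  afterInside (_ ∷ _ ∷ _) h = tt , h
  afterOutside : (q : Subset n) → HitsWindows q → HitsWindows (outside ∷ inside ∷ q)
  afterOutside []      _ = tt
  afterOutside (z ∷ q) h = tt , afterInside (z ∷ q) h
hitsWindows-every3rd 0 = tt
hitsWindows-every3rd 1 = tt
hitsWindows-every3rd 2 = tt

hitsWindows⇒removalSet₁ : (V' : Subset n) → HitsWindows V' → IsRemovalSet (Path n) 1 V'
hitsWindows⇒removalSet₁ V' hits =
  maxDegree≤1⇒chromaticIndexAtMost-1 (any? λ v → ¬? (v ∈? V'))
    (hitsConsecutiveTriples⇒maxDegree≤1 V' (hitsWindows⇒hitsConsecutiveTriples V' hits))

removalSet₁⇒hitsWindows : (V' : Subset n) → IsRemovalSet (Path n) 1 V' → HitsWindows V'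
removalSet₁⇒hitsWindows V' removal =
  hitsConsecutiveTriples⇒hitsWindows V'
    (maxDegree≤1⇒hitsConsecutiveTriples V' (chromaticIndexAtMost-1⇒maxDegree≤1 removal))

∅-removalSet : ∀ n → 1 < k → IsRemovalSet (Path n) k ∅
∅-removalSet (suc (suc (suc n))) 1<k = 2 , (restrictColouring pathColouring₂ , atLeast2) , 1<k
  where
  atLeast2 : ∀ m → ProperEdgeColouring (Path (3 + n) ─ ∅) m → 2 ≤ m
  atLeast2 _ = 2≤colours {u = suc zero , ∉⊥} {v = zero , ∉⊥} {w = suc (suc zero) , ∉⊥}
    (inj₂ refl) (inj₁ refl) (λ ())
∅-removalSet 0 1<k = chromaticIndexAtMost-mono (<⇒≤ 1<k) (hitsWindows⇒removalSet₁ ∅ tt)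
∅-removalSet 1 1<k = chromaticIndexAtMost-mono (<⇒≤ 1<k) (hitsWindows⇒removalSet₁ ∅ tt)
∅-removalSet 2 1<k = chromaticIndexAtMost-mono (<⇒≤ 1<k) (hitsWindows⇒removalSet₁ ∅ tt)

mainTheorem14 : (n k : ℕ) → 1 ≤ k →
    ((1 < k → IsLambdaV (Path n) k 0) × (k ≡ 1 → IsLambdaV (Path n) k (n / 3)))
mainTheorem14 n k _ = noRemoval , λ { refl → everyThirdOptimal }
  where
  noRemoval : 1 < k → IsLambdaV (Path n) k 0
  noRemoval 1<k = (∅ , ∅-removalSet n 1<k , ∣⊥∣≡0 n) , λ _ _ → z≤n

  everyThirdOptimal : IsLambdaV (Path n) 1 (n / 3)
  everyThirdOptimal =
    (every3rd n , hitsWindows⇒removalSet₁ (every3rd n) (hitsWindows-every3rd n) , ∣every3rd∣≡n/3 n) ,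
    λ V' removal → hitsWindows⇒n/3≤∣p∣ V' (removalSet₁⇒hitsWindows V' removal)
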